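{- Let $\mathcal{GO}=\langle t,\prec,\phi\rangle$ be a GOMT problem with $\phi$ satisfiable, let $\langle\mathcal{I},\Delta,\tau\rangle$ be a state in a $\mathcal{GO}$-derivation, and let $\mathcal{J}$ be a $\mathcal{GO}$-consistent $\mathcal{T}$-interpretation. Then $\mathcal{J}\models\Delta$ if and only if $\mathcal{J}<_{\mathcal{GO}}\mathcal{I}$.
   Context: Fix a many-sorted first-order theory $\mathcal{T}$ with signature $\Sigma$; interpretations are $\mathcal{T}$-interpretations assigning values to all variables, and $\models$ means $\models_{\mathcal{T}}$. A GOMT problem is $\mathcal{GO}=\langle t,\prec,\phi\rangle$: $t$ a $\Sigma$-term of sort $\sigma$, $\prec$ a strict partial order on values of sort $\sigma$ definable in $\mathcal{T}$, $\phi$ a $\Sigma$-formula. $\mathcal{I}$ is $\mathcal{GO}$-consistent if $\mathcal{I}\models\phi$; $\mathcal{I}<_{\mathcal{GO}}\mathcal{I}'$ if both are $\mathcal{GO}$-consistent and $t^{\mathcal{I}}\prec t^{\mathcal{I}'}$. $\textsc{Solve}$ maps a formula to an interpretation satisfying it if satisfiable, else to $\bot$. $\textsc{Better}$ maps each $\mathcal{GO}$-consistent $\mathcal{I}$ to a formula with: for every $\mathcal{GO}$-consistent $\mathcal{I}'$, $\mathcal{I}'\models\textsc{Better}(\mathcal{I})$ iff $\mathcal{I}'<_{\mathcal{GO}}\mathcal{I}$. $\textsc{Top}(s_1,\dots,s_n)=s_1$, $\textsc{Pop}(s_1,\dots,s_n)=(s_2,\dots,s_n)$, $\emptyset$ the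 empty sequence, $\circ$ concatenation. A state is $\langle\mathcal{I},\Delta,\tau\rangle$ (interpretation, formula, finite sequence of formulas). Initial state: $\mathcal{I}_0=\textsc{Solve}(\phi)$, $\Delta_0=\textsc{Better}(\mathcal{I}_0)$, $\tau_0=(\Delta_0)$. Rules (unmentioned components unchanged): F-Split: if $\tau\neq\emptyset$, $\psi=\textsc{Top}(\tau)$, $\phi\models\psi\Leftrightarrow\bigvee_{j=1}^k\psi_j$, $k\ge1$, then $\tau:=(\psi_1,\dots,\psi_k)\circ\textsc{Pop}(\tau)$. F-Sat: if $\tau\neq\emptyset$, $\psi=\textsc{Top}(\tau)$, $\textsc{Solve}(\phi\wedge\psi)=\mathcal{I}'\neq\bot$, $\Delta'=\Delta\wedge\textsc{Better}(\mathcal{I}')$, then $\mathcal{I}:=\mathcal{I}'$, $\Delta:=\Delta'$, $\tau:=(\Delta')$. F-Close: if $\tau\neq\emptyset$, $\psi=\textsc{Top}(\tau)$, $\textsc{Solve}(\phi\wedge\psi)=\bot$, then $\Delta:=\Delta\wedge\neg\psi$, $\tau:=\textsc{Pop}(\tau)$. A rule applies if its premises hold and the resulting state differs. A $\mathcal{GO}$-derivation is a sequence of states starting at the initial state, each obtained from the previous by one rule. -}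

module Defs where

open import Data.Maybe using (Maybe; just; nothing)
open import Data.List using (List; []; _∷_; _++_)
open import Data.List.Relation.Unary.Any using (Any)
open import Data.Product using (_×_; ∃)
open import Relation.Nullary using (¬_)
open import Relation.Binary.PropositionalEquality using (_≡_; _≢_)
open import Relation.Binary.Structures using (IsStrictPartialOrder)
open import Function.Bundles using (_⇔_)

record Semantics : Set₁ where
  field
    Interp  : Set
    Formula : Set
    _⊨_     : Interp → Formula → Set
    _∧'_    : Formula → Formula → Formula
    ¬'_     : Formula → Formula
    ⊨-∧     : ∀ I a b → (I ⊨ (a ∧' b)) ⇔ ((I ⊨ a) × (I ⊨ b))
    ⊨-¬     : ∀ I a → (I ⊨ (¬' a)) ⇔ (¬ (I ⊨ a))

  Satisfiable : Formula → Set
  Satisfiable ψ = ∃ λ I → I ⊨ ψ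

-- A GOMT problem ⟨t, ≺, φ⟩.  The term t is given by its value map
-- I ↦ t^I into the carrier Val of its sort σ.
record GOMT (L : Semantics) : Set₁ where
  open Semantics L
  field
    Val    : Set
    _≺_    : Val → Val → Set
    ≺-spo  : IsStrictPartialOrder _≡_ _≺_
    t      : Interp → Val
    φ      : Formula

  Consistent : Interp → Set
  Consistent I = I ⊨ φ

  _<GO_ : Interp → Interp → Set
  I <GO I' = Consistent I × Consistent I' × (t I ≺ t I')

-- The functions Solve and Better with their specifications.
-- (Better is totalised; only its values at GO-consistent I are constrained/used.)
record Oracles (L : Semantics) (G : GOMT L) : Set₁ where
  open Semantics L
  open GOMT G
  field
    Solve          : Formula → Maybe Interp
    Solve-sound    : ∀ ψ I → Solve ψ ≡ just I → I ⊨ ψ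
    Solve-complete : ∀ ψ → Solve ψ ≡ nothing → ∀ I → ¬ (I ⊨ ψ)
    Better         : Interp → Formula
    Better-spec    : ∀ I → Consistent I → ∀ I' → Consistent I' →
                     (I' ⊨ Better I) ⇔ (I' <GO I)

module Framework (L : Semantics) (G : GOMT L) (O : Oracles L G) where
  open Semantics L
  open GOMT G
  open Oracles O

  record State : Set where
    constructor ⟨_,_,_⟩
    field
      Iₛ : Interp
      Δₛ : Formula
      τₛ : List Formula
  open State public

  initial : Interp → State
  initial I₀ = ⟨ I₀ , Better I₀ , Better I₀ ∷ [] ⟩

  -- Premises of the rules (τ ≠ ∅ is expressed by τ = ψ ∷ τ').
  data _⟶_ : State → State → Set where
    F-Split : ∀ {I Δ ψ τ} (ψs : List Formula) →
              ψs ≢ [] →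
              (∀ J → J ⊨ φ → (J ⊨ ψ) ⇔ Any (J ⊨_) ψs) →
              ⟨ I , Δ , ψ ∷ τ ⟩ ⟶ ⟨ I , Δ , ψs ++ τ ⟩
    F-Sat   : ∀ {I Δ ψ τ I'} →
              Solve (φ ∧' ψ) ≡ just I' →
              ⟨ I , Δ , ψ ∷ τ ⟩ ⟶
                ⟨ I' , Δ ∧' Better I' , (Δ ∧' Better I') ∷ [] ⟩
    F-Close : ∀ {I Δ ψ τ} →
              Solve (φ ∧' ψ) ≡ nothing →
              ⟨ I , Δ , ψ ∷ τ ⟩ ⟶ ⟨ I , Δ ∧' (¬' ψ) , τ ⟩

  -- States occurring in some GO-derivation.  A rule applies only if the
  -- resulting state differs from the current one.
  data InDerivation : State → Set where
    start : ∀ {I₀} → Solve φ ≡ just I₀ → InDerivation (initial I₀)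
    step  : ∀ {s s'} → InDerivation s → s ⟶ s' → s' ≢ s → InDerivation s'

-- The proof is an induction along the derivation with a stronger invariant:
-- I is GO-consistent, Δ holds in a consistent J exactly when J <GO I, and
-- every formula on the stack τ entails Δ modulo φ.  F-Split keeps the last
-- clause since each disjunct entails the split formula modulo φ; F-Close
-- conjoins ¬ψ, which holds in every model of φ; F-Sat finds I' with ψ, hence
-- Δ, so I' <GO I, and by transitivity of ≺ the new Δ ∧ Better I' captures
-- exactly the interpretations better than I'.
module Submission where

open import Defs
open import Function.Bundles using (_⇔_; mk⇔; Equivalence)
open import Data.Maybe using (just; nothing)
open import Data.List using ([]; _∷_)
open import Data.List.Membership.Propositional using (lose)
open import Data.List.Relation.Unary.All as All using (All; []; _∷_)
open import Data.List.Relation.Unary.All.Properties using (++⁺)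
open import Data.List.Relation.Unary.Any using (Any)
open import Data.Product using (_×_; _,_; proj₁; proj₂)
open import Relation.Binary.PropositionalEquality using (_≡_)
open import Relation.Binary.Structures using (IsStrictPartialOrder)

module Invariant (L : Semantics) (G : GOMT L) (O : Oracles L G) where
  open Semantics L
  open GOMT G
  open Oracles O
  open Framework L G O
  open Equivalence

  _⇒φ_ : Formula → Formula → Set
  ψ ⇒φ χ = ∀ J → Consistent J → J ⊨ ψ → J ⊨ χ

  ⇒φ-trans : ∀ {ψ χ ρ} → ψ ⇒φ χ → χ ⇒φ ρ → ψ ⇒φ ρ
  ⇒φ-trans f g J c p = g J c (f J c p)

  ⇒φ-refl : ∀ {ψ} → ψ ⇒φ ψ
  ⇒φ-refl J c p = p

  ValidModφ : Formula → Set
  ValidModφ χ = ∀ J → Consistent J → J ⊨ χ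

  ⇒φ-∧-valid : ∀ {ψ Δ χ} → ψ ⇒φ Δ → ValidModφ χ → ψ ⇒φ (Δ ∧' χ)
  ⇒φ-∧-valid {Δ = Δ} {χ} ψ⇒Δ χ-valid J c p = from (⊨-∧ J Δ χ) (ψ⇒Δ J c p , χ-valid J c)

  disjuncts⇒φ : ∀ {ψ ψs} → (∀ J → J ⊨ φ → (J ⊨ ψ) ⇔ Any (J ⊨_) ψs) →
                All (_⇒φ ψ) ψs
  disjuncts⇒φ split = All.tabulate λ ψ′∈ψs J c p → from (split J c) (lose ψ′∈ψs p)

  Solve-φ∧-sound : ∀ {ψ I} → Solve (φ ∧' ψ) ≡ just I → Consistent I × I ⊨ ψ
  Solve-φ∧-sound {ψ} {I} eq = to (⊨-∧ I φ ψ) (Solve-sound _ _ eq)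

  Solve-φ∧-complete : ∀ {ψ} → Solve (φ ∧' ψ) ≡ nothing → ValidModφ (¬' ψ)
  Solve-φ∧-complete {ψ} eq J c =
    from (⊨-¬ J ψ) λ p → Solve-complete _ eq J (from (⊨-∧ J φ ψ) (c , p))

  _Characterises_ : Formula → Interp → Set
  Δ Characterises I = ∀ J → Consistent J → (J ⊨ Δ) ⇔ (J <GO I)

  ∧-valid-characterises : ∀ {Δ χ I} → Δ Characterises I →
                          ValidModφ χ → (Δ ∧' χ) Characterises I
  ∧-valid-characterises {Δ} {χ} Δ↔ χ-valid J c = mk⇔
    (λ p → to (Δ↔ J c) (proj₁ (to (⊨-∧ J Δ χ) p)))
    (λ lt → from (⊨-∧ J Δ χ) (from (Δ↔ J c) lt , χ-valid J c))

  ∧-Better-characterises : ∀ {Δ I I'} → Δ Characterises I → Consistent I → Consistent I' →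
                           I' <GO I → (Δ ∧' Better I') Characterises I'
  ∧-Better-characterises {Δ} {I} {I'} Δ↔ cI cI' (_ , _ , I'≺I) J c = mk⇔
    (λ p → to (Better-spec I' cI' J c) (proj₂ (to (⊨-∧ J Δ (Better I')) p)))
    (λ { J<I'@(_ , _ , J≺I') → from (⊨-∧ J Δ (Better I'))
         ( from (Δ↔ J c) (c , cI , trans J≺I' I'≺I)
         , from (Better-spec I' cI' J c) J<I') })
    where open IsStrictPartialOrder ≺-spo using (trans)

  record Holds (s : State) : Set where
    field
      consistent    : Consistent (Iₛ s)
      characterises : Δₛ s Characterises Iₛ s
      stack⇒φΔ      : All (_⇒φ Δₛ s) (τₛ s)
  open Holds

  initial-holds : ∀ {I₀} → Solve φ ≡ just I₀ → Holds (initial I₀)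
  initial-holds {I₀} eq = record
    { consistent    = cI₀
    ; characterises = Better-spec I₀ cI₀
    ; stack⇒φΔ      = ⇒φ-refl ∷ []
    }
    where cI₀ = Solve-sound _ _ eq

  ⟶-preserves : ∀ {s s'} → Holds s → s ⟶ s' → Holds s'
  ⟶-preserves {⟨ I , Δ , ψ ∷ τ ⟩} h (F-Split ψs _ split) with stack⇒φΔ h
  ... | ψ⇒Δ ∷ τ⇒Δ = record
    { consistent    = consistent h
    ; characterises = characterises h
    ; stack⇒φΔ      = ++⁺ (All.map (λ ψ′⇒ψ → ⇒φ-trans ψ′⇒ψ ψ⇒Δ) (disjuncts⇒φ split)) τ⇒Δ
    }
  ⟶-preserves {⟨ I , Δ , ψ ∷ τ ⟩} h (F-Sat {I' = I'} eq) with stack⇒φΔ h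
  ... | ψ⇒Δ ∷ _ = record
    { consistent    = cI'
    ; characterises = ∧-Better-characterises (characterises h) (consistent h) cI' I'<I
    ; stack⇒φΔ      = ⇒φ-refl ∷ []
    }
    where
      cI' = proj₁ (Solve-φ∧-sound eq)
      I'<I : I' <GO I
      I'<I = to (characterises h I' cI') (ψ⇒Δ I' cI' (proj₂ (Solve-φ∧-sound eq)))
  ⟶-preserves {⟨ I , Δ , ψ ∷ τ ⟩} h (F-Close eq) with stack⇒φΔ h
  ... | _ ∷ τ⇒Δ = record
    { consistent    = consistent h
    ; characterises = ∧-valid-characterises (characterises h) ¬ψ-valid
    ; stack⇒φΔ      = All.map (λ χ⇒Δ → ⇒φ-∧-valid χ⇒Δ ¬ψ-valid) τ⇒Δ
    }
    where ¬ψ-valid = Solve-φ∧-complete eq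

  holds : ∀ {s} → InDerivation s → Holds s
  holds (start eq)    = initial-holds eq
  holds (step d st _) = ⟶-preserves (holds d) st

lemma5 : (L : Semantics) (G : GOMT L) (O : Oracles L G) →
         Semantics.Satisfiable L (GOMT.φ G) →
         ∀ (s : Framework.State L G O) → Framework.InDerivation L G O s →
         ∀ (J : Semantics.Interp L) → GOMT.Consistent G J →
         (Semantics._⊨_ L J (Framework.Δₛ {L} {G} {O} s)) ⇔ (GOMT._<GO_ G J (Framework.Iₛ {L} {G} {O} s))
lemma5 L G O _ s d = Invariant.Holds.characterises (Invariant.holds L G O d)
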